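{- Let $\sigma$ and $\theta$ be finite substitutions such that $\theta$ is an extension of $\sigma$, and let $J$ be a non-trivial model of $\mathrm{FEA}(L)$. Then $\theta\approx_J\sigma$ iff $\theta$ is a regular extension of $\sigma$.
   Context: $L$ is a first-order language with equality whose function symbols include at least one constant. $\mathrm{FEA}(L)$ (free equality axioms): $f(\bar x)=f(\bar y)\leftrightarrow x_1=y_1\wedge\dots\wedge x_n=y_n$ for each $n$-ary $f$; $f(\bar x)=g(\bar y)\leftrightarrow\mathit{False}$ for distinct function symbols $f,g$; $x=t\leftrightarrow\mathit{False}$ whenever $x\not\equiv t$ and $x$ occurs in $t$. A pre-interpretation $J$ has nonempty domain $U_J$ and interprets the function symbols ($=$ is identity); $V_J$ is the set of $J$-valuations (maps from variables to $U_J$, extended to terms). $J$ is a non-trivial model of $\mathrm{FEA}(L)$ if the axioms are true in $J$ and $|U_J|\ge2$. A finite substitution $\sigma$ maps a finite set $\mathrm{Dom}(\sigma)$ of variables to terms; $\mathrm{Range}(\sigma)$ is the set of variables occurring in its values. $h\in V_J$ is a $J$-instance of $\sigma$ if there is $g\in V_J$ with $h(x)=g(\sigma(x))$ for all $x\in\mathrm{Dom}(\sigma)$; $\mathrm{Inst}_J(\sigma)$ is the set of $J$-instances. $\sigma\approx_J\theta$ iff $\mathrm{Inst}_J(\sigma)=\mathrm{Inst}_J(\theta)$. $\theta$ is an extension of $\sigma$ if $\mathrm{Dom}(\sigma)\subseteq\mathrm{Dom}(\theta)$ and $\theta(x)=\sigma(x)$ for $x\in\mathrm{Dom}(\sigma)$.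 $\theta$ is a regular extension of $\sigma$ if it is an extension of $\sigma$ and it maps the set $\mathrm{Dom}(\theta)\setminus\mathrm{Dom}(\sigma)$ injectively into the set of variables not belonging to $\mathrm{Range}(\sigma)$. -}

module Defs where

open import Data.Nat using (ℕ)
open import Data.Vec using (Vec; []; _∷_)
open import Data.Vec.Membership.Propositional using () renaming (_∈_ to _∈ᵥ_)
open import Data.List using (List)
open import Data.List.Membership.Propositional using (_∈_; _∉_)
open import Data.Product using (Σ; ∃; ∃-syntax; _×_; _,_)
open import Data.Empty using (⊥)
open import Relation.Nullary using (¬_)
open import Relation.Binary.PropositionalEquality using (_≡_; _≢_)
open import Function.Bundles using (_⇔_)

Var : Set
Var = ℕ

-- A first-order language (function symbols only; equality is built in),
-- containing at least one constant.
record Language : Set₁ where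
  field
    FunSym   : Set
    arity    : FunSym → ℕ
    constant : ∃[ c ] (arity c ≡ 0)

module _ (L : Language) where
  open Language L

  data Term : Set where
    var : Var → Term
    fun : (f : FunSym) → Vec Term (arity f) → Term

  data _occursIn_ (x : Var) : Term → Set where
    here  : x occursIn var x
    inArg : ∀ {f} {ts : Vec Term (arity f)} {t} → t ∈ᵥ ts → x occursIn t → x occursIn fun f ts

  record PreInterp : Set₁ where
    field
      U      : Set
      U-nonempty : U
      interp : (f : FunSym) → Vec U (arity f) → U

  module _ (J : PreInterp) where
    open PreInterp J

    Valuation : Set
    Valuation = Var → U

    mutual
      eval : Valuation → Term → U
      eval v (var x)    = v x
      eval v (fun f ts) = interp f (evalVec v ts)

      evalVec : ∀ {n} → Valuation → Vec Term n → Vec U n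
      evalVec v []       = []
      evalVec v (t ∷ ts) = eval v t ∷ evalVec v ts

    -- J is a model of FEA(L) (universal closures of the axioms hold in J)
    record ModelFEA : Set where
      field
        fea-inj    : ∀ f (xs ys : Vec U (arity f)) → (interp f xs ≡ interp f ys) ⇔ (xs ≡ ys)
        fea-clash  : ∀ f g → f ≢ g → (xs : Vec U (arity f)) (ys : Vec U (arity g)) →
                     ¬ (interp f xs ≡ interp g ys)
        fea-occurs : ∀ (x : Var) (t : Term) → t ≢ var x → x occursIn t →
                     (v : Valuation) → ¬ (v x ≡ eval v t)

    NonTrivialModelFEA : Set
    NonTrivialModelFEA = ModelFEA × (Σ U λ a → Σ U λ b → a ≢ b)

  -- Finite substitution: a finite domain (given as a list) and the map.
  -- Only the values on the domain are relevant.
  record Subst : Set where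
    field
      dom : List Var
      app : Var → Term

  open Subst

  InRange : Var → Subst → Set
  InRange y σ = ∃[ x ] (x ∈ dom σ × y occursIn app σ x)

  IsExtension : Subst → Subst → Set
  IsExtension θ σ = (∀ {x} → x ∈ dom σ → x ∈ dom θ)
                  × (∀ {x} → x ∈ dom σ → app θ x ≡ app σ x)

  IsRegularExtension : Subst → Subst → Set
  IsRegularExtension θ σ =
    IsExtension θ σ
    × (∀ {x} → x ∈ dom θ → x ∉ dom σ → ∃[ y ] (app θ x ≡ var y × ¬ InRange y σ))
    × (∀ {x x'} → x ∈ dom θ → x ∉ dom σ → x' ∈ dom θ → x' ∉ dom σ →
         app θ x ≡ app θ x' → x ≡ x')

  module _ (J : PreInterp) where
    open PreInterp J

    IsInstance : Subst → Valuation J → Set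
    IsInstance σ h = ∃[ g ] (∀ {x} → x ∈ dom σ → h x ≡ eval J g (app σ x))

    EquivJ : Subst → Subst → Set
    EquivJ σ θ = ∀ (h : Valuation J) → IsInstance σ h ⇔ IsInstance θ h

{-# OPTIONS --safe #-}
module Submission where

open import Defs
open import Data.Bool using (if_then_else_)
open import Data.Empty using (⊥-elim)
open import Data.List.Membership.Propositional using (_∈_; _∉_; find; lose)
open import Data.List.Relation.Unary.Any using (any?)
open import Data.Nat.Properties using (_≟_)
open import Data.List.Membership.DecPropositional _≟_ using (_∈?_)
open import Data.Product using (_×_; ∃-syntax; _,_; proj₁; proj₂)
open import Data.Vec using (Vec; []; _∷_)
open import Data.Vec.Membership.Propositional using () renaming (_∈_ to _∈ᵥ_)
open import Data.Vec.Properties using (∷-injectiveˡ; ∷-injectiveʳ)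
open import Data.Vec.Relation.Unary.Any using (here; there)
open import Function.Bundles using (_⇔_; mk⇔; Equivalence)
open import Relation.Nullary using (¬_; Dec; does; yes; no)
open import Relation.Nullary.Decidable using (map′; ¬?; _×-dec_; dec-true; dec-false)
open import Relation.Binary.PropositionalEquality
open ≡-Reasoning

-- Every J-instance of θ is one of σ. If θ sends its new variables to pairwise
-- distinct variables outside Range(σ), an instance h = g ∘ σ of σ becomes an
-- instance of θ by redefining g at each θ(x) to be h(x).
-- If instead every instance of σ is one of θ, then in a free model the new
-- variables are independent of σ: any values on them extend an instance of σ
-- to one of θ. So each new θ(x) evaluates onto U and must be a variable y (a
-- compound term misses a second point or the constant); y cannot occur in σ,
-- because free equality makes a term's value determine the values of its
-- variables; and distinct new variables can be given distinct values, so
-- their images differ.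

var-injective : ∀ {L} {y z : Var} → var {L} y ≡ var z → y ≡ z
var-injective refl = refl

_≟var_ : ∀ {L} (t : Term L) (y : Var) → Dec (t ≡ var y)
var x ≟var y = map′ (cong var) var-injective (x ≟ y)
fun f ts ≟var y = no λ ()

module Evaluation (L : Language) (J : PreInterp L) where
  open Language L
  open PreInterp J

  mutual
    eval-cong-occurring : ∀ (g g' : Valuation L J) t →
                          (∀ y → _occursIn_ L y t → g y ≡ g' y) → eval L J g t ≡ eval L J g' t
    eval-cong-occurring g g' (var x)    agree = agree x here
    eval-cong-occurring g g' (fun f ts) agree =
      cong (interp f) (evalVec-cong-occurring g g' ts λ y t∈ts y∈t → agree y (inArg t∈ts y∈t))

    evalVec-cong-occurring : ∀ (g g' : Valuation L J) {n} (ts : Vec (Term L) n) →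
                             (∀ y {t} → t ∈ᵥ ts → _occursIn_ L y t → g y ≡ g' y) →
                             evalVec L J g ts ≡ evalVec L J g' ts
    evalVec-cong-occurring g g' []       agree = refl
    evalVec-cong-occurring g g' (t ∷ ts) agree =
      cong₂ _∷_ (eval-cong-occurring g g' t λ y → agree y (here refl))
                (evalVec-cong-occurring g g' ts λ y t∈ts → agree y (there t∈ts))

  evalVec-≡⇒eval-≡ : ∀ (g g' : Valuation L J) {n t} {ts : Vec (Term L) n} → t ∈ᵥ ts →
                     evalVec L J g ts ≡ evalVec L J g' ts → eval L J g t ≡ eval L J g' t
  evalVec-≡⇒eval-≡ g g' (here refl)  eq = ∷-injectiveˡ eq
  evalVec-≡⇒eval-≡ g g' (there t∈ts) eq = evalVec-≡⇒eval-≡ g g' t∈ts (∷-injectiveʳ eq)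

  eval-≡⇒occurring-≡ : ModelFEA L J → ∀ (g g' : Valuation L J) {t y} →
                       eval L J g t ≡ eval L J g' t → _occursIn_ L y t → g y ≡ g' y
  eval-≡⇒occurring-≡ model g g' eq here = eq
  eval-≡⇒occurring-≡ model g g' eq (inArg t∈ts y∈t) =
    eval-≡⇒occurring-≡ model g g'
      (evalVec-≡⇒eval-≡ g g' t∈ts (Equivalence.to (ModelFEA.fea-inj model _ _ _) eq)) y∈t

  EvalSurjective : Term L → Set
  EvalSurjective t = ∀ u → ∃[ g ] eval L J g t ≡ u

  fun-not-surjective : NonTrivialModelFEA L J → ∀ f ts → ¬ EvalSurjective (fun f ts)
  fun-not-surjective (model , a , b , a≢b) f ts surj with arity f ≟ 0
  ... | yes arity≡0 = a≢b (begin
    a                                  ≡⟨ sym (proj₂ (surj a)) ⟩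
    interp f (evalVec L J (proj₁ (surj a)) ts) ≡⟨ cong (interp f) (length-zero-unique arity≡0 _ _) ⟩
    interp f (evalVec L J (proj₁ (surj b)) ts) ≡⟨ proj₂ (surj b) ⟩
    b                                  ∎)
    where
      length-zero-unique : ∀ {n} → n ≡ 0 → (us vs : Vec U n) → us ≡ vs
      length-zero-unique refl [] [] = refl
  ... | no arity≢0 =
    ModelFEA.fea-clash model c f c≢f c-args _ (sym (proj₂ (surj (interp c c-args))))
    where
      c : FunSym
      c = proj₁ constant
      c-args : Vec U (arity c)
      c-args = subst (Vec U) (sym (proj₂ constant)) []
      c≢f : c ≢ f
      c≢f refl = arity≢0 (proj₂ constant)

  surjective⇒var : NonTrivialModelFEA L J → ∀ t → EvalSurjective t → ∃[ y ] t ≡ var y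
  surjective⇒var nontrivial (var y)    surj = y , refl
  surjective⇒var nontrivial (fun f ts) surj = ⊥-elim (fun-not-surjective nontrivial f ts surj)

module Instances (L : Language) (J : PreInterp L) (σ θ : Subst L) (ext : IsExtension L θ σ) where
  open PreInterp J
  open Subst
  open Evaluation L J

  NewVarsFresh : Set
  NewVarsFresh = ∀ {x} → x ∈ dom θ → x ∉ dom σ → ∃[ y ] (app θ x ≡ var y × ¬ InRange L y σ)

  NewVarsInjective : Set
  NewVarsInjective = ∀ {x x'} → x ∈ dom θ → x ∉ dom σ → x' ∈ dom θ → x' ∉ dom σ →
                     app θ x ≡ app θ x' → x ≡ x'

  restrict-instance : ∀ h → IsInstance L J θ h → IsInstance L J σ h
  restrict-instance h (g , h≡gθ) = g , λ x∈σ → trans (h≡gθ (proj₁ ext x∈σ)) (cong (eval L J g) (proj₂ ext x∈σ))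

  module Regular (fresh : NewVarsFresh) (injective : NewVarsInjective) where

    ImageOfNewVar : Var → Set
    ImageOfNewVar y = ∃[ x ] (x ∈ dom θ × x ∉ dom σ × app θ x ≡ var y)

    imageOfNewVar? : ∀ y → Dec (ImageOfNewVar y)
    imageOfNewVar? y =
      map′ find (λ (x , x∈θ , new) → lose x∈θ new)
           (any? (λ x → ¬? (x ∈? dom σ) ×-dec (app θ x ≟var y)) (dom θ))

    range-∉-image : ∀ {y} → InRange L y σ → ¬ ImageOfNewVar y
    range-∉-image y∈range (x , x∈θ , x∉σ , θx≡y) with fresh x∈θ x∉σ
    ... | y' , θx≡y' , y'∉range =
      y'∉range (subst (λ z → InRange L z σ) (var-injective (trans (sym θx≡y) θx≡y')) y∈range)

    extendValuation : (h g : Valuation L J) → Valuation L J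
    extendValuation h g y with imageOfNewVar? y
    ... | yes (x , _) = h x
    ... | no _        = g y

    extendValuation-outside : ∀ h g {y} → ¬ ImageOfNewVar y → extendValuation h g y ≡ g y
    extendValuation-outside h g {y} ¬image with imageOfNewVar? y
    ... | yes image = ⊥-elim (¬image image)
    ... | no _      = refl

    extendValuation-image : ∀ h g {x y} → x ∈ dom θ → x ∉ dom σ → app θ x ≡ var y →
                            extendValuation h g y ≡ h x
    extendValuation-image h g {x} {y} x∈θ x∉σ θx≡y with imageOfNewVar? y
    ... | yes (x' , x'∈θ , x'∉σ , θx'≡y) = cong h (injective x'∈θ x'∉σ x∈θ x∉σ (trans θx'≡y (sym θx≡y)))
    ... | no ¬image                      = ⊥-elim (¬image (x , x∈θ , x∉σ , θx≡y))

    regular⇒instance : ∀ h → IsInstance L J σ h → IsInstance L J θ h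
    regular⇒instance h (g , h≡gσ) = g' , h≡g'θ
      where
        g' : Valuation L J
        g' = extendValuation h g

        h≡g'θ : ∀ {x} → x ∈ dom θ → h x ≡ eval L J g' (app θ x)
        h≡g'θ {x} x∈θ with x ∈? dom σ
        ... | yes x∈σ = begin
          h x                    ≡⟨ h≡gσ x∈σ ⟩
          eval L J g (app σ x)   ≡⟨ eval-cong-occurring g g' (app σ x) (λ y y∈σx →
                                      sym (extendValuation-outside h g (range-∉-image (x , x∈σ , y∈σx)))) ⟩
          eval L J g' (app σ x)  ≡⟨ cong (eval L J g') (proj₂ ext x∈σ) ⟨
          eval L J g' (app θ x)  ∎
        ... | no x∉σ with fresh x∈θ x∉σ
        ...   | y , θx≡y , _ = begin
          h x                    ≡⟨ extendValuation-image h g x∈θ x∉σ θx≡y ⟨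
          g' y                   ≡⟨ cong (eval L J g') θx≡y ⟨
          eval L J g' (app θ x)  ∎

  module Forward (σ⊆θ : ∀ h → IsInstance L J σ h → IsInstance L J θ h) where

    patch : (g₀ k : Valuation L J) → Valuation L J
    patch g₀ k z with z ∈? dom σ
    ... | yes _ = eval L J g₀ (app σ z)
    ... | no _  = k z

    patch-∈ : ∀ g₀ k {z} → z ∈ dom σ → patch g₀ k z ≡ eval L J g₀ (app σ z)
    patch-∈ g₀ k {z} z∈σ with z ∈? dom σ
    ... | yes _   = refl
    ... | no z∉σ  = ⊥-elim (z∉σ z∈σ)

    patch-∉ : ∀ g₀ k {z} → z ∉ dom σ → patch g₀ k z ≡ k z
    patch-∉ g₀ k {z} z∉σ with z ∈? dom σ
    ... | yes z∈σ = ⊥-elim (z∉σ z∈σ)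
    ... | no _    = refl

    new-vars-independent : (g₀ k : Valuation L J) →
      ∃[ g ] ((∀ {z} → z ∈ dom σ → eval L J g (app σ z) ≡ eval L J g₀ (app σ z))
            × (∀ {x} → x ∈ dom θ → x ∉ dom σ → eval L J g (app θ x) ≡ k x))
    new-vars-independent g₀ k with σ⊆θ (patch g₀ k) (g₀ , patch-∈ g₀ k)
    ... | g , patch≡gθ = g , σ-kept , new-get-k
      where
        σ-kept : ∀ {z} → z ∈ dom σ → eval L J g (app σ z) ≡ eval L J g₀ (app σ z)
        σ-kept {z} z∈σ = begin
          eval L J g (app σ z)   ≡⟨ cong (eval L J g) (proj₂ ext z∈σ) ⟨
          eval L J g (app θ z)   ≡⟨ patch≡gθ (proj₁ ext z∈σ) ⟨
          patch g₀ k z           ≡⟨ patch-∈ g₀ k z∈σ ⟩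
          eval L J g₀ (app σ z)  ∎

        new-get-k : ∀ {x} → x ∈ dom θ → x ∉ dom σ → eval L J g (app θ x) ≡ k x
        new-get-k x∈θ x∉σ = trans (sym (patch≡gθ x∈θ)) (patch-∉ g₀ k x∉σ)

    new-var-surjective : ∀ {x} → x ∈ dom θ → x ∉ dom σ → EvalSurjective (app θ x)
    new-var-surjective x∈θ x∉σ u with new-vars-independent (λ _ → u) (λ _ → u)
    ... | g , _ , new-get-u = g , new-get-u x∈θ x∉σ

    new-vars-fresh : NonTrivialModelFEA L J → NewVarsFresh
    new-vars-fresh nontrivial@(model , a , b , a≢b) {x} x∈θ x∉σ
      with surjective⇒var nontrivial (app θ x) (new-var-surjective x∈θ x∉σ)
    ... | y , θx≡y = y , θx≡y , y∉range
      where
        y∉range : ¬ InRange L y σ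
        y∉range (z , z∈σ , y∈σz) with new-vars-independent (λ _ → a) (λ _ → b)
        ... | g , σ-kept , new-get-b = a≢b (begin
          a    ≡⟨ eval-≡⇒occurring-≡ model g (λ _ → a) (σ-kept z∈σ) y∈σz ⟨
          g y  ≡⟨ cong (eval L J g) θx≡y ⟨
          eval L J g (app θ x) ≡⟨ new-get-b x∈θ x∉σ ⟩
          b    ∎)

    new-vars-injective : {a b : U} → a ≢ b → NewVarsInjective
    new-vars-injective {a} {b} a≢b {x} {x'} x∈θ x∉σ x'∈θ x'∉σ θx≡θx' with x ≟ x'
    ... | yes x≡x' = x≡x'
    ... | no x≢x' = ⊥-elim (a≢b (separated x≢x'))
      where
        a-at-x : Valuation L J
        a-at-x z = if does (x ≟ z) then a else b

        separated : x ≢ x' → a ≡ b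
        separated x≢x' with new-vars-independent (λ _ → a) a-at-x
        ... | g , _ , new-get-k = begin
          a                      ≡⟨ cong (if_then a else b) (dec-true (x ≟ x) refl) ⟨
          a-at-x x               ≡⟨ new-get-k x∈θ x∉σ ⟨
          eval L J g (app θ x)   ≡⟨ cong (eval L J g) θx≡θx' ⟩
          eval L J g (app θ x')  ≡⟨ new-get-k x'∈θ x'∉σ ⟩
          a-at-x x'              ≡⟨ cong (if_then a else b) (dec-false (x ≟ x') x≢x') ⟩
          b                      ∎

proposition5p9 : (L : Language) (J : PreInterp L) (σ θ : Subst L) →
                 IsExtension L θ σ → NonTrivialModelFEA L J →
                 EquivJ L J θ σ ⇔ IsRegularExtension L θ σ
proposition5p9 L J σ θ ext nontrivial@(_ , _ , _ , a≢b) = mk⇔ regular equivalent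
  where
    open Instances L J σ θ ext

    regular : EquivJ L J θ σ → IsRegularExtension L θ σ
    regular θ≈σ = ext , new-vars-fresh nontrivial , new-vars-injective a≢b
      where open Forward (λ h → Equivalence.from (θ≈σ h))

    equivalent : IsRegularExtension L θ σ → EquivJ L J θ σ
    equivalent (_ , fresh , injective) h =
      mk⇔ (restrict-instance h) (Regular.regular⇒instance fresh injective h)
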